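{- Let $F(u,v)=F(u,v;t)=\sum_{p,q\ge1}f_{p,q}(t)u^pv^q$, where $f_{p,q}(t)=\sum_{n\ge1}t^n\,|\{e\in{\bf I}_n(201,210): e\text{ has parameters }(p,q)\}|$. Then $$F(u,v)=tuv+t\biggl(\frac{uF(u,v)-vF(v,v)}{1-v/u}+u^2v\biggl(\left.\frac{\partial F(u,v)}{\partial v}\right|_{v=1}-F(u,1)\biggr)\biggr).$$ Equivalently, writing $F(u,v)=\sum_{n\ge1}f_n(u,v)t^n$, one has $f_1(u,v)=uv$ and for $n\ge2$ $$f_n(u,v)=\frac{uf_{n-1}(u,v)-vf_{n-1}(v,v)}{1-v/u}+u^2v\biggl(\left.\frac{\partial f_{n-1}(u,v)}{\partial v}\right|_{v=1}-f_{n-1}(u,1)\biggr).$$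
   Context: ${\bf I}_n=\{(e_1,\dots,e_n)\in\mathbb{N}^n:0\le e_i<i\}$; ${\bf I}_n(201,210)$ consists of those $e$ with no indices $i<j<k$ such that $e_j<e_k<e_i$ or $e_k<e_j<e_i$. The parameters of $e\in{\bf I}_n(201,210)$ are $(p,q)$ where $p=|\{k>e_n:(e_1,\dots,e_n,k)\in{\bf I}_{n+1}(201,210)\}|$ and $q=|\{k\le e_n:(e_1,\dots,e_n,k)\in{\bf I}_{n+1}(201,210)\}|$. -}

module Defs where

open import Data.Nat as ℕ using (ℕ; zero; suc)
import Data.Nat.Properties as ℕP
open import Data.Fin as Fin using (Fin)
import Data.Fin.Properties as FinP
open import Data.Vec using (Vec; []; _∷ʳ_; lookup; last)
open import Data.List using (List; []; _∷_; map; concatMap; filter; upTo; length; sum)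
open import Data.Integer as ℤ using (ℤ; _*_; _^_)
open import Data.Product using (_×_)
open import Data.Sum using (_⊎_)
open import Relation.Nullary using (¬_; Dec)
open import Relation.Nullary.Decidable using (_×-dec_; _⊎-dec_; _→-dec_; ¬?)

-- A sequence is a Vec ℕ n; position (Fin) i (0-based) holds e_{i+1}.
-- invSeqs n enumerates I n (each element exactly once): every element of
-- I (n+1) is uniquely (e_1,…,e_n) ∈ I n followed by some k with 0 ≤ k < n+1.
invSeqs : (n : ℕ) → List (Vec ℕ n)
invSeqs zero    = [] ∷ []
invSeqs (suc n) = concatMap (λ e → map (λ k → e ∷ʳ k) (upTo (suc n))) (invSeqs n)

Pattern : ∀ {n} → Vec ℕ n → Fin n → Fin n → Fin n → Set
Pattern e i j k =
  (lookup e j ℕ.< lookup e k × lookup e k ℕ.< lookup e i)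
  ⊎ (lookup e k ℕ.< lookup e j × lookup e j ℕ.< lookup e i)

Avoids : ∀ {n} → Vec ℕ n → Set
Avoids {n} e = (i j k : Fin n) → i Fin.< j → j Fin.< k → ¬ Pattern e i j k

avoids? : ∀ {n} (e : Vec ℕ n) → Dec (Avoids e)
avoids? e = FinP.all? λ i → FinP.all? λ j → FinP.all? λ k →
  (i FinP.<? j) →-dec (j FinP.<? k) →-dec ¬? (pat? i j k)
  where
  pat? : ∀ i j k → Dec (Pattern e i j k)
  pat? i j k =
    ((lookup e j ℕP.<? lookup e k) ×-dec (lookup e k ℕP.<? lookup e i))
    ⊎-dec ((lookup e k ℕP.<? lookup e j) ×-dec (lookup e j ℕP.<? lookup e i))

avoiders : (n : ℕ) → List (Vec ℕ n)
avoiders n = filter avoids? (invSeqs n)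

-- Parameters (p,q) of e ∈ I_{n+1}(201,210) (n+1 ≥ 1 so e_{n+1} = last e exists):
-- p = #{ k > e_{n+1} : (e,k) ∈ I_{n+2}(201,210) },
-- q = #{ k ≤ e_{n+1} : (e,k) ∈ I_{n+2}(201,210) }.
-- (e,k) ∈ I_{n+2} means 0 ≤ k < n+2, i.e. k ∈ upTo (suc (suc n)).
paramP : ∀ {n} → Vec ℕ (suc n) → ℕ
paramP {n} e = length (filter (λ k → avoids? (e ∷ʳ k))
                 (filter (λ k → last e ℕP.<? k) (upTo (suc (suc n)))))

paramQ : ∀ {n} → Vec ℕ (suc n) → ℕ
paramQ {n} e = length (filter (λ k → avoids? (e ∷ʳ k))
                 (filter (λ k → k ℕP.≤? last e) (upTo (suc (suc n)))))

-- f_n(u,v) = Σ_{p,q} |{e ∈ I_n(201,210) with parameters (p,q)}| u^p v^q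
--          = Σ_{e ∈ I_n(201,210)} u^{p(e)} v^{q(e)}, evaluated at integers u, v.
-- (f_0 = 0 since F only has terms t^n with n ≥ 1.)
f : ℕ → ℤ → ℤ → ℤ
f zero    u v = ℤ.0ℤ
f (suc n) u v = sum' (map (λ e → (u ^ paramP e) * (v ^ paramQ e)) (avoiders (suc n)))
  where
  sum' : List ℤ → ℤ
  sum' []       = ℤ.0ℤ
  sum' (x ∷ xs) = x ℤ.+ sum' xs

-- (∂ f_n(u,v) / ∂v) at v = 1, i.e. Σ_{e} q(e) u^{p(e)}
-- (the formal derivative of Σ u^p v^q is Σ q u^p v^(q-1)).
df : ℕ → ℤ → ℤ
df zero    u = ℤ.0ℤ
df (suc n) u = sum' (map (λ e → ℤ.+ (paramQ e) * (u ^ paramP e)) (avoiders (suc n)))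
  where
  sum' : List ℤ → ℤ
  sum' []       = ℤ.0ℤ
  sum' (x ∷ xs) = x ℤ.+ sum' xs

{-# OPTIONS --safe #-}
module Submission where

-- Appending x to a (201,210)-avoiding e is allowed exactly when every inversion e_j < e_i (i < j)
-- with x < e_i has e_j = x.  Let a be the last entry of e ∈ I_n(201,210) and call the admissible
-- next entries its children; a is one, and so is n.  A child k ≥ a admits the same next entries
-- as e together with the new top value n + 1, so it has parameters
-- (1 + #{children > k}, #{children ≤ k}).  A child k < a admits only k, the children ≥ a and
-- n + 1, so its parameters are (p + 2, 1), where (p, q) are the parameters of e.  Summing
-- u^p′ v^q′ over the children, those ≥ a form a telescoping sum and those < a give
-- (q - 1) u^(p+2) v; after multiplying by u - v this is exactly the contribution of u^p v^q to
-- the right-hand side, which is linear in f.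

open import Data.Empty using (⊥-elim)
open import Data.Fin as Fin using (Fin; fromℕ; inject₁)
open import Data.Fin.Properties using (toℕ-inject₁; toℕ-fromℕ; toℕ<n; ≤fromℕ)
open import Data.Fin.Relation.Unary.Top using (view; ‵fromℕ; ‵inject₁)
open import Data.Integer using (ℤ; +_; 0ℤ; 1ℤ; _+_; _-_; _*_; _^_)
import Data.Integer.Properties as ℤ
open import Data.Integer.Tactic.RingSolver using (solve-∀)
open import Data.List using (List; []; _∷_; _++_; [_]; length; filter; upTo; map; foldr; concatMap)
open import Data.List.Properties
  using ( filter-accept; filter-reject; filter-++; filter-all; filter-none; filter-≐; length-++
        ; ++-assoc; ++-identityʳ; upTo-∷ʳ; map-cong-local; concatMap-cong; map-∘; foldr-universal)
open import Data.List.Relation.Unary.All as All using (All; []; _∷_)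
open import Data.List.Relation.Unary.All.Properties using (all-upTo; all-filter; filter⁺; map⁺; concat⁺)
open import Data.Nat as ℕ using (ℕ; zero; suc; _≤_; _<_; _∸_; z≤n; s≤s; s≤s⁻¹; _≤?_; _<?_)
open import Data.Nat.Properties
  using ( _≟_; ≤-refl; ≤-trans; <-trans; <⇒≤; <⇒≢; <⇒≱; ≮⇒≥; ≤∧≢⇒<; ≤-<-trans
        ; <-≤-trans; +-suc; +-comm; +-identityʳ; m≤m+n; m+[n∸m]≡n; m≤n⇒∃[o]m+o≡n; m<n⇒m<1+n; n≤1+n)
open import Data.Product using (_×_; _,_; proj₁; proj₂; map₂)
open import Data.Sum using (_⊎_; inj₁; inj₂; [_,_]′)
open import Data.Vec using (Vec; []; _∷_; _∷ʳ_; lookup; last)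
open import Data.Vec.Properties using (last-∷ʳ)
import Data.Vec.Relation.Unary.All as Vec
open import Data.Vec.Relation.Unary.All.Properties using (lookup⁺)
open import Function using (_∘_; id)
open import Function.Bundles using (_⇔_; mk⇔; Equivalence)
open import Level using (0ℓ)
open import Relation.Binary.PropositionalEquality
  using (_≡_; _≢_; refl; sym; trans; cong; cong₂; subst; subst₂; module ≡-Reasoning)
open import Relation.Nullary using (¬_; yes; no)
open import Relation.Unary using (Pred; Decidable; _≐_; _∩_)
open import Relation.Unary.Properties using (_∩?_)

open import Defs

-- Extending a pattern-avoiding sequence by one entry

lookup-∷ʳ-inject₁ : ∀ {n} (e : Vec ℕ n) x i → lookup (e ∷ʳ x) (inject₁ i) ≡ lookup e i
lookup-∷ʳ-inject₁ (y ∷ e) x Fin.zero    = refl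
lookup-∷ʳ-inject₁ (y ∷ e) x (Fin.suc i) = lookup-∷ʳ-inject₁ e x i

lookup-∷ʳ-fromℕ : ∀ {n} (e : Vec ℕ n) x → lookup (e ∷ʳ x) (fromℕ n) ≡ x
lookup-∷ʳ-fromℕ []      x = refl
lookup-∷ʳ-fromℕ (y ∷ e) x = lookup-∷ʳ-fromℕ e x

lookup-fromℕ : ∀ {n} (e : Vec ℕ (suc n)) → lookup e (fromℕ n) ≡ last e
lookup-fromℕ (x ∷ [])    = refl
lookup-fromℕ (x ∷ y ∷ e) = lookup-fromℕ (y ∷ e)

inject₁-mono-< : ∀ {n} {i j : Fin n} → i Fin.< j → inject₁ i Fin.< inject₁ j
inject₁-mono-< {i = i} {j} = subst₂ _<_ (sym (toℕ-inject₁ i)) (sym (toℕ-inject₁ j))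

inject₁-cancel-< : ∀ {n} {i j : Fin n} → inject₁ i Fin.< inject₁ j → i Fin.< j
inject₁-cancel-< {i = i} {j} = subst₂ _<_ (toℕ-inject₁ i) (toℕ-inject₁ j)

inject₁<fromℕ : ∀ {n} (i : Fin n) → inject₁ i Fin.< fromℕ n
inject₁<fromℕ {n} i = subst₂ _<_ (sym (toℕ-inject₁ i)) (sym (toℕ-fromℕ n)) (toℕ<n i)

fromℕ≮ : ∀ {n} (i : Fin (suc n)) → ¬ (fromℕ n Fin.< i)
fromℕ≮ i fromℕ<i = <⇒≱ fromℕ<i (≤fromℕ i)

-- Pattern e i j k unfolds to PatternValues (lookup e i) (lookup e j) (lookup e k).
PatternValues : ℕ → ℕ → ℕ → Set
PatternValues a b c = (b < c × c < a) ⊎ (c < b × b < a)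

patternValues-cong : ∀ {a a′ b b′ c c′} → a ≡ a′ → b ≡ b′ → c ≡ c′ →
                     PatternValues a b c → PatternValues a′ b′ c′
patternValues-cong refl refl refl p = p

patternValues-intro : ∀ {a b c} → b < a → c < a → c ≢ b → PatternValues a b c
patternValues-intro {b = b} {c} b<a c<a c≢b with c <? b
... | yes c<b = inj₂ (c<b , b<a)
... | no  c≮b = inj₁ (≤∧≢⇒< (≮⇒≥ c≮b) (c≢b ∘ sym) , c<a)

patternValues-elim : ∀ {a b c} → PatternValues a b c → b < a × c < a × c ≢ b
patternValues-elim (inj₁ (b<c , c<a)) = <-trans b<c c<a , c<a , <⇒≢ b<c ∘ sym
patternValues-elim (inj₂ (c<b , b<a)) = b<a , <-trans c<b b<a , <⇒≢ c<b

Appendable : ∀ {n} → Vec ℕ n → ℕ → Set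
Appendable {n} e x =
  (i j : Fin n) → i Fin.< j → lookup e j < lookup e i → x < lookup e i → x ≡ lookup e j

Compatible : ∀ {n} → Vec ℕ n → ℕ → ℕ → Set
Compatible {n} e k x = (i : Fin n) → k < lookup e i → x < lookup e i → x ≡ k

module _ {n} (e : Vec ℕ n) (x : ℕ) where

  appendable⇒¬pattern : Appendable e x → ∀ {i j} → i Fin.< j →
                         ¬ PatternValues (lookup e i) (lookup e j) x
  appendable⇒¬pattern appendable {i} {j} i<j p with ej<ei , x<ei , x≢ej ← patternValues-elim p =
    x≢ej (appendable i j i<j ej<ei x<ei)

  avoids-init : Avoids (e ∷ʳ x) → Avoids e
  avoids-init avoids i j k i<j j<k p =
    avoids (inject₁ i) (inject₁ j) (inject₁ k) (inject₁-mono-< i<j) (inject₁-mono-< j<k)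
      (patternValues-cong (sym (lookup-∷ʳ-inject₁ e x i)) (sym (lookup-∷ʳ-inject₁ e x j))
                          (sym (lookup-∷ʳ-inject₁ e x k)) p)

  avoids⇒appendable : Avoids (e ∷ʳ x) → Appendable e x
  avoids⇒appendable avoids i j i<j ej<ei x<ei with x ≟ lookup e j
  ... | yes x≡ej = x≡ej
  ... | no  x≢ej = ⊥-elim (avoids (inject₁ i) (inject₁ j) (fromℕ n)
          (inject₁-mono-< i<j) (inject₁<fromℕ j)
          (patternValues-cong (sym (lookup-∷ʳ-inject₁ e x i)) (sym (lookup-∷ʳ-inject₁ e x j))
                              (sym (lookup-∷ʳ-fromℕ e x)) (patternValues-intro ej<ei x<ei x≢ej)))

  avoids-∷ʳ : Avoids e → Appendable e x → Avoids (e ∷ʳ x)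
  avoids-∷ʳ avoids appendable i j k i<j j<k p with view k | view j | view i
  ... | ‵fromℕ      | ‵fromℕ      | _           = fromℕ≮ _ j<k
  ... | ‵fromℕ      | ‵inject₁ _  | ‵fromℕ      = fromℕ≮ _ i<j
  ... | ‵fromℕ      | ‵inject₁ j′ | ‵inject₁ i′ =
    appendable⇒¬pattern appendable (inject₁-cancel-< i<j)
      (patternValues-cong (lookup-∷ʳ-inject₁ e x i′) (lookup-∷ʳ-inject₁ e x j′)
                          (lookup-∷ʳ-fromℕ e x) p)
  ... | ‵inject₁ _  | ‵fromℕ      | _           = fromℕ≮ _ j<k
  ... | ‵inject₁ _  | ‵inject₁ _  | ‵fromℕ      = fromℕ≮ _ i<j
  ... | ‵inject₁ k′ | ‵inject₁ j′ | ‵inject₁ i′ =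
    avoids i′ j′ k′ (inject₁-cancel-< i<j) (inject₁-cancel-< j<k)
      (patternValues-cong (lookup-∷ʳ-inject₁ e x i′) (lookup-∷ʳ-inject₁ e x j′)
                          (lookup-∷ʳ-inject₁ e x k′) p)

module _ {n} (e : Vec ℕ n) (k x : ℕ) where

  appendable-init : Appendable (e ∷ʳ k) x → Appendable e x
  appendable-init appendable i j i<j
    with appendable (inject₁ i) (inject₁ j) (inject₁-mono-< i<j)
  ... | conclusion rewrite lookup-∷ʳ-inject₁ e k i | lookup-∷ʳ-inject₁ e k j = conclusion

  appendable⇒compatible : Appendable (e ∷ʳ k) x → Compatible e k x
  appendable⇒compatible appendable i
    with appendable (inject₁ i) (fromℕ n) (inject₁<fromℕ i)
  ... | conclusion rewrite lookup-∷ʳ-inject₁ e k i | lookup-∷ʳ-fromℕ e k = conclusion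

  appendable-∷ʳ : Appendable e x → Compatible e k x → Appendable (e ∷ʳ k) x
  appendable-∷ʳ appendable compatible i j i<j with view j | view i
  ... | ‵fromℕ      | ‵fromℕ      = ⊥-elim (fromℕ≮ _ i<j)
  ... | ‵fromℕ      | ‵inject₁ i′
    rewrite lookup-∷ʳ-inject₁ e k i′ | lookup-∷ʳ-fromℕ e k = compatible i′
  ... | ‵inject₁ _  | ‵fromℕ      = ⊥-elim (fromℕ≮ _ i<j)
  ... | ‵inject₁ j′ | ‵inject₁ i′
    rewrite lookup-∷ʳ-inject₁ e k i′ | lookup-∷ʳ-inject₁ e k j′ =
    appendable i′ j′ (inject₁-cancel-< i<j)

appendable-≥ : ∀ {n b x} {e : Vec ℕ n} → Vec.All (_< b) e → b ≤ x → Appendable e x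
appendable-≥ bounded b≤x i _ _ _ x<ei = ⊥-elim (<⇒≱ (<-trans x<ei (lookup⁺ bounded i)) b≤x)

module _ {n} (e : Vec ℕ (suc n)) where

  appendable-last : Avoids e → Appendable e (last e)
  appendable-last avoids i j i<j ej<ei a<ei with view j
  ... | ‵fromℕ = sym (lookup-fromℕ e)
  ... | ‵inject₁ j′ with last e ≟ lookup e (inject₁ j′)
  ...   | yes a≡ej = a≡ej
  ...   | no  a≢ej = ⊥-elim (avoids i (inject₁ j′) (fromℕ n) i<j (inject₁<fromℕ j′)
            (patternValues-cong refl refl (sym (lookup-fromℕ e)) (patternValues-intro ej<ei a<ei a≢ej)))

  appendable⇒≡last : ∀ {x} → Appendable e x → ∀ i → last e < lookup e (inject₁ i) →
                     x < lookup e (inject₁ i) → x ≡ lookup e (fromℕ n)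
  appendable⇒≡last appendable i a<ei = appendable (inject₁ i) (fromℕ n) (inject₁<fromℕ i)
    (subst (_< lookup e (inject₁ i)) (sym (lookup-fromℕ e)) a<ei)

  compatible-above-last : ∀ k x → Appendable e k → last e ≤ k → Appendable e x → Compatible e k x
  compatible-above-last k x appendable-k a≤k appendable-x i k<ei x<ei with view i
  ... | ‵fromℕ rewrite lookup-fromℕ e = ⊥-elim (<⇒≱ k<ei a≤k)
  ... | ‵inject₁ i′ =
    trans (appendable⇒≡last appendable-x i′ a<ei x<ei)
          (sym (appendable⇒≡last appendable-k i′ a<ei k<ei))
    where
    a<ei : last e < lookup e (inject₁ i′)
    a<ei = ≤-<-trans a≤k k<ei

  compatible-below-last : ∀ k x → Appendable e k → k < last e →
                          Compatible e k x ⇔ (last e ≤ x ⊎ x ≡ k)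
  compatible-below-last k x appendable-k k<a = mk⇔ to from
    where
    to : Compatible e k x → last e ≤ x ⊎ x ≡ k
    to compatible with x <? last e
    ... | yes x<a = inj₂ (compatible (fromℕ n) (subst (k <_) (sym (lookup-fromℕ e)) k<a)
                                               (subst (x <_) (sym (lookup-fromℕ e)) x<a))
    ... | no  x≮a = inj₁ (≮⇒≥ x≮a)
    from : last e ≤ x ⊎ x ≡ k → Compatible e k x
    from (inj₂ x≡k) _ _ _ = x≡k
    from (inj₁ a≤x) i k<ei x<ei with view i
    ... | ‵fromℕ rewrite lookup-fromℕ e = ⊥-elim (<⇒≱ x<ei a≤x)
    ... | ‵inject₁ i′ = ⊥-elim (<⇒≢ k<a (trans k≡a (lookup-fromℕ e)))
      where
      k≡a : k ≡ lookup e (fromℕ n)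
      k≡a = appendable⇒≡last appendable-k i′ (≤-<-trans a≤x x<ei) k<ei

-- Counting and summing over ranges

module _ {a p} {A : Set a} {P : Pred A p} (P? : Decidable P) where

  filter-filter : ∀ {q} {Q : Pred A q} (Q? : Decidable Q) xs →
                  filter Q? (filter P? xs) ≡ filter (P? ∩? Q?) xs
  filter-filter Q? [] = refl
  filter-filter Q? (x ∷ xs) with P? x
  ... | no  _ = filter-filter Q? xs
  ... | yes _ with Q? x
  ...   | yes _ = cong (x ∷_) (filter-filter Q? xs)
  ...   | no  _ = filter-filter Q? xs

  filter-map : ∀ {b} {B : Set b} (g : B → A) xs → filter P? (map g xs) ≡ map g (filter (P? ∘ g) xs)
  filter-map g []       = refl
  filter-map g (x ∷ xs) with P? (g x)
  ... | yes _ = cong (g x ∷_) (filter-map g xs)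
  ... | no  _ = filter-map g xs

  filter-concatMap : ∀ {b} {B : Set b} (h : B → List A) xs →
                     filter P? (concatMap h xs) ≡ concatMap (filter P? ∘ h) xs
  filter-concatMap h []       = refl
  filter-concatMap h (x ∷ xs) =
    trans (filter-++ P? (h x) _) (cong (filter P? (h x) ++_) (filter-concatMap h xs))

  concatMap-filter : ∀ {b} {B : Set b} (h : A → List B) → (∀ {x} → ¬ P x → h x ≡ []) →
                     ∀ xs → concatMap h xs ≡ concatMap h (filter P? xs)
  concatMap-filter h vanishes []       = refl
  concatMap-filter h vanishes (x ∷ xs) with P? x
  ... | yes _  = cong (h x ++_) (concatMap-filter h vanishes xs)
  ... | no ¬Px = trans (cong (_++ concatMap h xs) (vanishes ¬Px)) (concatMap-filter h vanishes xs)

count : ∀ {a p} {A : Set a} {P : Pred A p} → Decidable P → List A → ℕ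
count P? xs = length (filter P? xs)

count-≐ : ∀ {a p q} {A : Set a} {P : Pred A p} {Q : Pred A q} (P? : Decidable P) (Q? : Decidable Q) →
          P ≐ Q → ∀ xs → count P? xs ≡ count Q? xs
count-≐ P? Q? P≐Q xs = cong length (filter-≐ P? Q? P≐Q xs)

count-∩-≐ : ∀ {a r p q} {A : Set a} {R : Pred A r} {P : Pred A p} {Q : Pred A q}
            (R? : Decidable R) (P? : Decidable P) (Q? : Decidable Q) →
            P ≐ Q → ∀ xs → count (R? ∩? P?) xs ≡ count (R? ∩? Q?) xs
count-∩-≐ R? P? Q? (P⊆Q , Q⊆P) = count-≐ (R? ∩? P?) (R? ∩? Q?) (map₂ P⊆Q , map₂ Q⊆P)

interval : ℕ → ℕ → List ℕ
interval k zero    = []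
interval k (suc l) = k ∷ interval (suc k) l

upTo-++-interval : ∀ k l → upTo (k ℕ.+ l) ≡ upTo k ++ interval k l
upTo-++-interval k zero    = trans (cong upTo (+-identityʳ k)) (sym (++-identityʳ (upTo k)))
upTo-++-interval k (suc l) = begin
  upTo (k ℕ.+ suc l)                       ≡⟨ cong upTo (+-suc k l) ⟩
  upTo (suc k ℕ.+ l)                       ≡⟨ upTo-++-interval (suc k) l ⟩
  upTo (suc k) ++ interval (suc k) l       ≡⟨ cong (_++ interval (suc k) l) (upTo-∷ʳ k) ⟨
  (upTo k ++ [ k ]) ++ interval (suc k) l  ≡⟨ ++-assoc (upTo k) [ k ] (interval (suc k) l) ⟩
  upTo k ++ interval k (suc l)             ∎
  where open ≡-Reasoning

all-interval : ∀ k l → All (λ x → k ≤ x × x < k ℕ.+ l) (interval k l)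
all-interval k zero    = []
all-interval k (suc l) =
  (≤-refl , subst (k <_) (sym (+-suc k l)) (s≤s (m≤m+n k l)))
  ∷ All.map (λ {x} (k<x , x<) → <⇒≤ k<x , subst (x <_) (sym (+-suc k l)) x<) (all-interval (suc k) l)

module _ {p} {P : Pred ℕ p} (P? : Decidable P) where

  count-++ : ∀ xs ys → count P? (xs ++ ys) ≡ count P? xs ℕ.+ count P? ys
  count-++ xs ys = trans (cong length (filter-++ P? xs ys)) (length-++ (filter P? xs))

  count-upTo-suc : ∀ M → count P? (upTo (suc M)) ≡ count P? (upTo M) ℕ.+ count P? [ M ]
  count-upTo-suc M = trans (cong (count P?) (sym (upTo-∷ʳ M))) (count-++ (upTo M) [ M ])

  count-upTo-accept : ∀ {M} → P M → count P? (upTo (suc M)) ≡ suc (count P? (upTo M))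
  count-upTo-accept {M} PM = trans (count-upTo-suc M)
    (trans (cong (λ ys → count P? (upTo M) ℕ.+ length ys) (filter-accept P? PM)) (+-comm _ 1))

  count-upTo-reject : ∀ {M} → ¬ P M → count P? (upTo (suc M)) ≡ count P? (upTo M)
  count-upTo-reject {M} ¬PM = trans (count-upTo-suc M)
    (trans (cong (λ ys → count P? (upTo M) ℕ.+ length ys) (filter-reject P? ¬PM)) (+-identityʳ _))

  count-from : ∀ c l {M} → c ℕ.+ l ≡ M →
               count ((c ≤?_) ∩? P?) (upTo M) ≡ count P? (interval c l)
  count-from c l refl = begin
    count ((c ≤?_) ∩? P?) (upTo (c ℕ.+ l))
      ≡⟨ cong length (filter-filter (c ≤?_) P? (upTo (c ℕ.+ l))) ⟨
    count P? (filter (c ≤?_) (upTo (c ℕ.+ l)))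
      ≡⟨ cong (count P? ∘ filter (c ≤?_)) (upTo-++-interval c l) ⟩
    count P? (filter (c ≤?_) (upTo c ++ interval c l))
      ≡⟨ cong (count P?) (filter-++ (c ≤?_) (upTo c) _) ⟩
    count P? (filter (c ≤?_) (upTo c) ++ filter (c ≤?_) (interval c l))
      ≡⟨ cong₂ (λ ys zs → count P? (ys ++ zs))
               (filter-none (c ≤?_) (All.map <⇒≱ (all-upTo c)))
               (filter-all (c ≤?_) (All.map proj₁ (all-interval c l))) ⟩
    count P? (interval c l) ∎
    where open ≡-Reasoning

  count-below : ∀ c l {M} → suc c ℕ.+ l ≡ M →
                count ((_≤? c) ∩? P?) (upTo M) ≡ count P? (upTo (suc c))
  count-below c l refl = begin
    count ((_≤? c) ∩? P?) (upTo (suc c ℕ.+ l))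
      ≡⟨ cong length (filter-filter (_≤? c) P? (upTo (suc c ℕ.+ l))) ⟨
    count P? (filter (_≤? c) (upTo (suc c ℕ.+ l)))
      ≡⟨ cong (count P? ∘ filter (_≤? c)) (upTo-++-interval (suc c) l) ⟩
    count P? (filter (_≤? c) (upTo (suc c) ++ interval (suc c) l))
      ≡⟨ cong (count P?) (filter-++ (_≤? c) (upTo (suc c)) _) ⟩
    count P? (filter (_≤? c) (upTo (suc c)) ++ filter (_≤? c) (interval (suc c) l))
      ≡⟨ cong₂ (λ ys zs → count P? (ys ++ zs))
               (filter-all (_≤? c) (All.map s≤s⁻¹ (all-upTo (suc c))))
               (filter-none (_≤? c) (All.map (<⇒≱ ∘ proj₁) (all-interval (suc c) l))) ⟩
    count P? (upTo (suc c) ++ [])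
      ≡⟨ cong (count P?) (++-identityʳ (upTo (suc c))) ⟩
    count P? (upTo (suc c)) ∎
    where open ≡-Reasoning

count-≡ : ∀ {c M} → c < M → count (_≟ c) (upTo M) ≡ 1
count-≡ {c} c<M with l , refl ← m≤n⇒∃[o]m+o≡n c<M = begin
  count (_≟ c) (upTo (suc c ℕ.+ l))
    ≡⟨ cong (count (_≟ c)) (upTo-++-interval (suc c) l) ⟩
  count (_≟ c) (upTo (suc c) ++ interval (suc c) l)
    ≡⟨ count-++ (_≟ c) (upTo (suc c)) _ ⟩
  count (_≟ c) (upTo (suc c)) ℕ.+ count (_≟ c) (interval (suc c) l)
    ≡⟨ cong₂ ℕ._+_ (count-upTo-accept (_≟ c) refl) none-above ⟩
  suc (count (_≟ c) (upTo c)) ℕ.+ 0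
    ≡⟨ cong (λ n → suc n ℕ.+ 0) none-below ⟩
  1 ∎
  where
  open ≡-Reasoning
  none-below : count (_≟ c) (upTo c) ≡ 0
  none-below = cong length (filter-none (_≟ c) (All.map <⇒≢ (all-upTo c)))
  none-above : count (_≟ c) (interval (suc c) l) ≡ 0
  none-above = cong length
    (filter-none (_≟ c) (All.map (λ (c<x , _) → <⇒≢ c<x ∘ sym) (all-interval (suc c) l)))

sumMap : ∀ {a} {A : Set a} → (A → ℤ) → List A → ℤ
sumMap w xs = foldr _+_ 0ℤ (map w xs)

module _ {a} {A : Set a} where

  sumMap-++ : ∀ (w : A → ℤ) xs ys → sumMap w (xs ++ ys) ≡ sumMap w xs + sumMap w ys
  sumMap-++ w []       ys = sym (ℤ.+-identityˡ _)
  sumMap-++ w (x ∷ xs) ys =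
    trans (cong (λ s → w x + s) (sumMap-++ w xs ys)) (sym (ℤ.+-assoc (w x) _ _))

  sumMap-cong : ∀ {w w′ : A → ℤ} {xs} → All (λ x → w x ≡ w′ x) xs →
                sumMap w xs ≡ sumMap w′ xs
  sumMap-cong = cong (foldr _+_ 0ℤ) ∘ map-cong-local

  sumMap-const : ∀ {w : A → ℤ} {c xs} → All (λ x → w x ≡ c) xs →
                 sumMap w xs ≡ + length xs * c
  sumMap-const {c = c} [] = sym (ℤ.*-zeroˡ c)
  sumMap-const {w = w} {c} {x ∷ xs} (wx≡c ∷ eqs) = begin
    w x + sumMap w xs        ≡⟨ cong₂ _+_ wx≡c (sumMap-const eqs) ⟩
    c + + length xs * c      ≡⟨ cong (_+ + length xs * c) (ℤ.*-identityˡ c) ⟨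
    1ℤ * c + + length xs * c ≡⟨ ℤ.*-distribʳ-+ c 1ℤ (+ length xs) ⟨
    + suc (length xs) * c    ∎
    where open ≡-Reasoning

  *-sumMap : ∀ c (w : A → ℤ) xs → c * sumMap w xs ≡ sumMap (λ x → c * w x) xs
  *-sumMap c w []       = ℤ.*-zeroʳ c
  *-sumMap c w (x ∷ xs) =
    trans (ℤ.*-distribˡ-+ c (w x) _) (cong (λ s → c * w x + s) (*-sumMap c w xs))

  sumMap-map : ∀ {b} {B : Set b} (w : B → ℤ) (g : A → B) xs →
               sumMap w (map g xs) ≡ sumMap (w ∘ g) xs
  sumMap-map w g xs = cong (foldr _+_ 0ℤ) (sym (map-∘ xs))

sumMap-concatMap : ∀ {a b} {A : Set a} {B : Set b} (w : B → ℤ) (h : A → List B) xs →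
                   sumMap w (concatMap h xs) ≡ sumMap (sumMap w ∘ h) xs
sumMap-concatMap w h []       = refl
sumMap-concatMap w h (x ∷ xs) =
  trans (sumMap-++ w (h x) _) (cong (λ s → sumMap w (h x) + s) (sumMap-concatMap w h xs))

rhs : ℤ → ℤ → ℤ → ℤ → ℤ → ℤ → ℤ
rhs u v A B C D = u * (u * A - v * B) + (u - v) * (u ^ 2) * v * (C - D)

rhs-+ : ∀ u v A B C D A′ B′ C′ D′ →
        rhs u v (A + A′) (B + B′) (C + C′) (D + D′) ≡ rhs u v A B C D + rhs u v A′ B′ C′ D′
rhs-+ u v = additive u v ((u - v) * (u ^ 2) * v)
  where
  additive : ∀ u v K A B C D A′ B′ C′ D′ →
             u * (u * (A + A′) - v * (B + B′)) + K * ((C + C′) - (D + D′))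
               ≡ (u * (u * A - v * B) + K * (C - D)) + (u * (u * A′ - v * B′) + K * (C′ - D′))
  additive = solve-∀

rhs-sumMap : ∀ {a} {A : Set a} u v (F G H K : A → ℤ) xs →
             rhs u v (sumMap F xs) (sumMap G xs) (sumMap H xs) (sumMap K xs)
               ≡ sumMap (λ x → rhs u v (F x) (G x) (H x) (K x)) xs
rhs-sumMap u v F G H K []       = vanishes u v ((u - v) * (u ^ 2) * v)
  where
  vanishes : ∀ u v K → u * (u * 0ℤ - v * 0ℤ) + K * (0ℤ - 0ℤ) ≡ 0ℤ
  vanishes = solve-∀
rhs-sumMap u v F G H K (x ∷ xs) =
  trans (rhs-+ u v (F x) (G x) (H x) (K x) _ _ _ _)
        (cong (λ s → rhs u v (F x) (G x) (H x) (K x) + s) (rhs-sumMap u v F G H K xs))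

module Telescope {p} {P : Pred ℕ p} (P? : Decidable P) (N : ℕ) where

  above : ℕ → ℕ
  above x = count ((x <?_) ∩? P?) (upTo N)

  atMost : ℕ → ℕ
  atMost x = count ((_≤? x) ∩? P?) (upTo N)

  module _ (u v : ℤ) where

    weight : ℕ → ℤ
    weight x = u ^ suc (above x) * v ^ atMost x

    -- Listing the elements of P in [k, N) as x₁ < … < x_c and writing d for the number of
    -- elements of P below k, the term of x_i is u^(c-i+1) v^(d+i), so the sum telescopes.
    telescope : ∀ k l → k ℕ.+ l ≡ N →
                (u - v) * sumMap weight (filter P? (interval k l))
                  ≡ u * u ^ count P? (interval k l) * (v * v ^ count P? (upTo k))
                    - u * (v * v ^ count P? (upTo k)) * v ^ count P? (interval k l)
    telescope k zero    _ = empty u v (v ^ count P? (upTo k))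
      where
      empty : ∀ u v D → (u - v) * 0ℤ ≡ u * 1ℤ * (v * D) - u * (v * D) * 1ℤ
      empty = solve-∀
    telescope k (suc l) k+1+l≡N with P? k
    ... | yes Pk = begin
      (u - v) * (weight k + sumMap weight (filter P? (interval (suc k) l)))
        ≡⟨ ℤ.*-distribˡ-+ (u - v) (weight k) _ ⟩
      (u - v) * weight k + (u - v) * sumMap weight (filter P? (interval (suc k) l))
        ≡⟨ cong₂ _+_ (cong ((u - v) *_) weight-k) (telescope (suc k) l k+1+l≡N′) ⟩
      (u - v) * (u ^ suc c * v ^ d′) + (u * u ^ c * (v * v ^ d′) - u * (v * v ^ d′) * v ^ c)
        ≡⟨ cong (λ d′ → (u - v) * (u ^ suc c * v ^ d′)
                        + (u * u ^ c * (v * v ^ d′) - u * (v * v ^ d′) * v ^ c))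
                (count-upTo-accept P? Pk) ⟩
      (u - v) * (u ^ suc c * v ^ suc d) + (u * u ^ c * (v * v ^ suc d) - u * (v * v ^ suc d) * v ^ c)
        ≡⟨ step u v (u ^ c) (v ^ c) (v ^ d) ⟩
      u * u ^ suc c * (v * v ^ d) - u * (v * v ^ d) * v ^ suc c ∎
      where
      open ≡-Reasoning
      c d d′ : ℕ
      c  = count P? (interval (suc k) l)
      d  = count P? (upTo k)
      d′ = count P? (upTo (suc k))
      k+1+l≡N′ : suc k ℕ.+ l ≡ N
      k+1+l≡N′ = trans (sym (+-suc k l)) k+1+l≡N
      weight-k : weight k ≡ u ^ suc c * v ^ d′
      weight-k = cong₂ (λ c d → u ^ suc c * v ^ d)
                       (count-from P? (suc k) l k+1+l≡N′) (count-below P? k l k+1+l≡N′)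
      step : ∀ u v U V D →
             (u - v) * (u * U * (v * D)) + (u * U * (v * (v * D)) - u * (v * (v * D)) * V)
               ≡ u * (u * U) * (v * D) - u * (v * D) * (v * V)
      step = solve-∀
    ... | no ¬Pk =
      trans (telescope (suc k) l (trans (sym (+-suc k l)) k+1+l≡N))
            (cong (λ d → u * u ^ c * (v * v ^ d) - u * (v * v ^ d) * v ^ c) (count-upTo-reject P? ¬Pk))
      where
      c : ℕ
      c = count P? (interval (suc k) l)

-- The children of one sequence

∷ʳ⁺ : ∀ {p n} {P : Pred ℕ p} {xs : Vec ℕ n} {x} → Vec.All P xs → P x → Vec.All P (xs ∷ʳ x)
∷ʳ⁺ Vec.[]         px = px Vec.∷ Vec.[]
∷ʳ⁺ (py Vec.∷ pxs) px = py Vec.∷ ∷ʳ⁺ pxs px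

invSeqs-bounded : ∀ n → All (Vec.All (_< n)) (invSeqs n)
invSeqs-bounded zero    = Vec.[] ∷ []
invSeqs-bounded (suc n) = concat⁺ (map⁺ (All.map extensions-bounded (invSeqs-bounded n)))
  where
  extensions-bounded : ∀ {e} → Vec.All (_< n) e →
                       All (Vec.All (_< suc n)) (map (e ∷ʳ_) (upTo (suc n)))
  extensions-bounded bounded = map⁺ (All.map (∷ʳ⁺ (Vec.map m<n⇒m<1+n bounded)) (all-upTo (suc n)))

avoiders-extend : ∀ {n} (ks : List ℕ) (es : List (Vec ℕ n)) →
                  filter avoids? (concatMap (λ e → map (e ∷ʳ_) ks) es)
                    ≡ concatMap (λ e → map (e ∷ʳ_) (filter (λ k → avoids? (e ∷ʳ k)) ks))
                                (filter avoids? es)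
avoiders-extend {n} ks es = begin
  filter avoids? (concatMap (λ e → map (e ∷ʳ_) ks) es)
    ≡⟨ filter-concatMap avoids? (λ e → map (e ∷ʳ_) ks) es ⟩
  concatMap (λ e → filter avoids? (map (e ∷ʳ_) ks)) es
    ≡⟨ concatMap-cong (λ e → filter-map avoids? (e ∷ʳ_) ks) es ⟩
  concatMap extensions es
    ≡⟨ concatMap-filter avoids? extensions no-extensions es ⟩
  concatMap extensions (filter avoids? es) ∎
  where
  open ≡-Reasoning
  extensions : Vec ℕ n → List (Vec ℕ (suc n))
  extensions e = map (e ∷ʳ_) (filter (λ k → avoids? (e ∷ʳ k)) ks)
  no-extensions : ∀ {e} → ¬ Avoids e → extensions e ≡ []
  no-extensions {e} ¬avoids = cong (map (e ∷ʳ_))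
    (filter-none (λ k → avoids? (e ∷ʳ k)) (All.universal (λ k → ¬avoids ∘ avoids-init e k) ks))

children : ∀ {n} → Vec ℕ n → List ℕ
children {n} e = filter (λ k → avoids? (e ∷ʳ k)) (upTo (suc n))

paramP-count : ∀ {n} (e : Vec ℕ (suc n)) →
               paramP e ≡ count ((last e <?_) ∩? λ x → avoids? (e ∷ʳ x)) (upTo (suc (suc n)))
paramP-count {n} e =
  cong length (filter-filter (last e <?_) (λ x → avoids? (e ∷ʳ x)) (upTo (suc (suc n))))

paramQ-count : ∀ {n} (e : Vec ℕ (suc n)) →
               paramQ e ≡ count ((_≤? last e) ∩? λ x → avoids? (e ∷ʳ x)) (upTo (suc (suc n)))
paramQ-count {n} e =
  cong length (filter-filter (_≤? last e) (λ x → avoids? (e ∷ʳ x)) (upTo (suc (suc n))))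

contribution : ℤ → ℤ → ℕ → ℕ → ℤ
contribution u v p q = rhs u v (u ^ p * v ^ q) (v ^ p * v ^ q) (+ q * u ^ p) (u ^ p * 1ℤ ^ q)

module Children {m} (e : Vec ℕ (suc m)) (avoids : Avoids e) (bounded : Vec.All (_< suc m) e) where

  N : ℕ
  N = suc (suc m)

  a : ℕ
  a = last e

  Child : Pred ℕ 0ℓ
  Child x = Avoids (e ∷ʳ x)

  child? : Decidable Child
  child? x = avoids? (e ∷ʳ x)

  Grandchild : ℕ → Pred ℕ 0ℓ
  Grandchild k x = Avoids (e ∷ʳ k ∷ʳ x)

  grandchild? : ∀ k → Decidable (Grandchild k)
  grandchild? k x = avoids? (e ∷ʳ k ∷ʳ x)

  grandchild⇒ : ∀ {k x} → Grandchild k x → Child x × Compatible e k x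
  grandchild⇒ {k} {x} g =
    avoids-∷ʳ e x avoids (appendable-init e k x ap) , appendable⇒compatible e k x ap
    where
    ap : Appendable (e ∷ʳ k) x
    ap = avoids⇒appendable (e ∷ʳ k) x g

  grandchild⇐ : ∀ {k x} → Child k → Child x → Compatible e k x → Grandchild k x
  grandchild⇐ {k} {x} ck cx compatible =
    avoids-∷ʳ (e ∷ʳ k) x ck (appendable-∷ʳ e k x (avoids⇒appendable e x cx) compatible)

  paramP-∷ʳ : ∀ k → paramP (e ∷ʳ k) ≡ count ((k <?_) ∩? grandchild? k) (upTo (suc N))
  paramP-∷ʳ k = trans (paramP-count (e ∷ʳ k))
                      (cong (λ b → count ((b <?_) ∩? grandchild? k) (upTo (suc N))) (last-∷ʳ k e))

  paramQ-∷ʳ : ∀ k → paramQ (e ∷ʳ k) ≡ count ((_≤? k) ∩? grandchild? k) (upTo (suc N))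
  paramQ-∷ʳ k = trans (paramQ-count (e ∷ʳ k))
                      (cong (λ b → count ((_≤? b) ∩? grandchild? k) (upTo (suc N))) (last-∷ʳ k e))

  a<N : a < N
  a<N = m<n⇒m<1+n (subst (_< suc m) (lookup-fromℕ e) (lookup⁺ bounded (fromℕ m)))

  child-a : Child a
  child-a = avoids-∷ʳ e a avoids (appendable-last e avoids)

  child-N : Child N
  child-N = avoids-∷ʳ e N avoids (appendable-≥ bounded (n≤1+n (suc m)))

  l : ℕ
  l = N ∸ suc a

  a+1+l≡N : suc a ℕ.+ l ≡ N
  a+1+l≡N = m+[n∸m]≡n a<N

  a+[1+l]≡N : a ℕ.+ suc l ≡ N
  a+[1+l]≡N = trans (+-suc a l) a+1+l≡N

  p₀ c₀ : ℕ
  p₀ = count child? (interval (suc a) l)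
  c₀ = count child? (upTo a)

  paramP≡p₀ : paramP e ≡ p₀
  paramP≡p₀ = trans (paramP-count e) (count-from child? (suc a) l a+1+l≡N)

  paramQ≡1+c₀ : paramQ e ≡ suc c₀
  paramQ≡1+c₀ =
    trans (paramQ-count e) (trans (count-below child? a l a+1+l≡N) (count-upTo-accept child? child-a))

  open Telescope child? N using (above; atMost; weight; telescope)

  module _ {k} (ck : Child k) (a≤k : a ≤ k) (k<N : k < N) where

    grandchild≐child : Grandchild k ≐ Child
    grandchild≐child = proj₁ ∘ grandchild⇒ , λ {x} cx → grandchild⇐ ck cx
      (compatible-above-last e k x (avoids⇒appendable e k ck) a≤k (avoids⇒appendable e x cx))

    paramP-child-≥ : paramP (e ∷ʳ k) ≡ suc (above k)
    paramP-child-≥ = begin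
      paramP (e ∷ʳ k)
        ≡⟨ paramP-∷ʳ k ⟩
      count ((k <?_) ∩? grandchild? k) (upTo (suc N))
        ≡⟨ count-∩-≐ (k <?_) (grandchild? k) child? grandchild≐child (upTo (suc N)) ⟩
      count ((k <?_) ∩? child?) (upTo (suc N))
        ≡⟨ count-upTo-accept ((k <?_) ∩? child?) (k<N , child-N) ⟩
      suc (above k) ∎
      where open ≡-Reasoning

    paramQ-child-≥ : paramQ (e ∷ʳ k) ≡ atMost k
    paramQ-child-≥ = begin
      paramQ (e ∷ʳ k)
        ≡⟨ paramQ-∷ʳ k ⟩
      count ((_≤? k) ∩? grandchild? k) (upTo (suc N))
        ≡⟨ count-∩-≐ (_≤? k) (grandchild? k) child? grandchild≐child (upTo (suc N)) ⟩
      count ((_≤? k) ∩? child?) (upTo (suc N))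
        ≡⟨ count-upTo-reject ((_≤? k) ∩? child?) (<⇒≱ k<N ∘ proj₁) ⟩
      atMost k ∎
      where open ≡-Reasoning

  module _ {k} (ck : Child k) (k<a : k < a) where

    compatible⇔ : ∀ x → Compatible e k x ⇔ (a ≤ x ⊎ x ≡ k)
    compatible⇔ x = compatible-below-last e k x (avoids⇒appendable e k ck) k<a

    paramP-child-< : paramP (e ∷ʳ k) ≡ suc (suc p₀)
    paramP-child-< = begin
      paramP (e ∷ʳ k)
        ≡⟨ paramP-∷ʳ k ⟩
      count ((k <?_) ∩? grandchild? k) (upTo (suc N))
        ≡⟨ count-≐ ((k <?_) ∩? grandchild? k) ((a ≤?_) ∩? child?) above≐from-a (upTo (suc N)) ⟩
      count ((a ≤?_) ∩? child?) (upTo (suc N))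
        ≡⟨ count-upTo-accept ((a ≤?_) ∩? child?) (<⇒≤ a<N , child-N) ⟩
      suc (count ((a ≤?_) ∩? child?) (upTo N))
        ≡⟨ cong suc (count-from child? a (suc l) a+[1+l]≡N) ⟩
      suc (count child? (interval a (suc l)))
        ≡⟨ cong (suc ∘ length) (filter-accept child? child-a) ⟩
      suc (suc p₀) ∎
      where
      open ≡-Reasoning
      above≐from-a : ((k <_) ∩ Grandchild k) ≐ ((a ≤_) ∩ Child)
      above≐from-a =
        (λ {x} (k<x , g) → let cx , compatible = grandchild⇒ g in
           [ (λ a≤x → a≤x , cx) , (λ x≡k → ⊥-elim (<⇒≢ k<x (sym x≡k))) ]′
             (Equivalence.to (compatible⇔ x) compatible))
        , (λ {x} (a≤x , cx) →
             <-≤-trans k<a a≤x , grandchild⇐ ck cx (Equivalence.from (compatible⇔ x) (inj₁ a≤x)))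

    paramQ-child-< : paramQ (e ∷ʳ k) ≡ 1
    paramQ-child-< = begin
      paramQ (e ∷ʳ k)
        ≡⟨ paramQ-∷ʳ k ⟩
      count ((_≤? k) ∩? grandchild? k) (upTo (suc N))
        ≡⟨ count-≐ ((_≤? k) ∩? grandchild? k) (_≟ k) atMost≐k (upTo (suc N)) ⟩
      count (_≟ k) (upTo (suc N))
        ≡⟨ count-≡ (<-trans k<a (m<n⇒m<1+n a<N)) ⟩
      1 ∎
      where
      open ≡-Reasoning
      atMost≐k : ((_≤ k) ∩ Grandchild k) ≐ (_≡ k)
      atMost≐k =
        (λ {x} (x≤k , g) → [ (λ a≤x → ⊥-elim (<⇒≱ k<a (≤-trans a≤x x≤k))) , id ]′
                              (Equivalence.to (compatible⇔ x) (proj₂ (grandchild⇒ g))))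
        , λ { refl → ≤-refl , grandchild⇐ ck ck (Equivalence.from (compatible⇔ k) (inj₂ refl)) }

  module _ (u v : ℤ) where

    childWeight : ℕ → ℤ
    childWeight x = u ^ paramP (e ∷ʳ x) * v ^ paramQ (e ∷ʳ x)

    lower upper : List ℕ
    lower = filter child? (upTo a)
    upper = filter child? (interval a (suc l))

    lower-sum : sumMap childWeight lower ≡ + c₀ * (u ^ suc (suc p₀) * v ^ 1)
    lower-sum =
      sumMap-const (All.zipWith weight≡ (filter⁺ child? (all-upTo a) , all-filter child? (upTo a)))
      where
      weight≡ : ∀ {x} → x < a × Child x → childWeight x ≡ u ^ suc (suc p₀) * v ^ 1
      weight≡ (x<a , cx) =
        cong₂ (λ p q → u ^ p * v ^ q) (paramP-child-< cx x<a) (paramQ-child-< cx x<a)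

    upper-sum : sumMap childWeight upper ≡ sumMap (weight u v) upper
    upper-sum =
      sumMap-cong (All.zipWith weight≡ (filter⁺ child? (all-interval a (suc l)) , all-filter child? _))
      where
      weight≡ : ∀ {x} → (a ≤ x × x < a ℕ.+ suc l) × Child x → childWeight x ≡ weight u v x
      weight≡ {x} ((a≤x , x<) , cx) =
        cong₂ (λ p q → u ^ p * v ^ q) (paramP-child-≥ cx a≤x x<N) (paramQ-child-≥ cx a≤x x<N)
        where
        x<N : x < N
        x<N = subst (x <_) a+[1+l]≡N x<

    children-sum : (u - v) * sumMap childWeight (children e) ≡ contribution u v (paramP e) (paramQ e)
    children-sum = begin
      (u - v) * sumMap childWeight (children e)
        ≡⟨ cong (λ xs → (u - v) * sumMap childWeight xs)
                (trans (cong (filter child?) upTo-N) (filter-++ child? (upTo a) _)) ⟩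
      (u - v) * sumMap childWeight (lower ++ upper)
        ≡⟨ cong ((u - v) *_) (sumMap-++ childWeight lower upper) ⟩
      (u - v) * (sumMap childWeight lower + sumMap childWeight upper)
        ≡⟨ cong₂ (λ s t → (u - v) * (s + t)) lower-sum upper-sum ⟩
      (u - v) * (+ c₀ * T + sumMap (weight u v) upper)
        ≡⟨ ℤ.*-distribˡ-+ (u - v) _ _ ⟩
      (u - v) * (+ c₀ * T) + (u - v) * sumMap (weight u v) upper
        ≡⟨ cong (λ s → (u - v) * (+ c₀ * T) + s) (telescope u v a (suc l) a+[1+l]≡N) ⟩
      (u - v) * (+ c₀ * T) + (u * u ^ c * (v * v ^ c₀) - u * (v * v ^ c₀) * v ^ c)
        ≡⟨ cong (λ c → (u - v) * (+ c₀ * T) + (u * u ^ c * (v * v ^ c₀) - u * (v * v ^ c₀) * v ^ c))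
                (cong length (filter-accept child? child-a)) ⟩
      (u - v) * (+ c₀ * T) + (u * u ^ suc p₀ * (v * v ^ c₀) - u * (v * v ^ c₀) * v ^ suc p₀)
        ≡⟨ collect u v (u ^ p₀) (v ^ p₀) (v ^ c₀) (+ c₀) ⟩
      rhs u v (u ^ p₀ * v ^ suc c₀) (v ^ p₀ * v ^ suc c₀) (+ suc c₀ * u ^ p₀) (u ^ p₀ * 1ℤ)
        ≡⟨ cong (λ o → rhs u v (u ^ p₀ * v ^ suc c₀) (v ^ p₀ * v ^ suc c₀)
                             (+ suc c₀ * u ^ p₀) (u ^ p₀ * o))
                (ℤ.^-zeroˡ (suc c₀)) ⟨
      contribution u v p₀ (suc c₀)
        ≡⟨ cong₂ (contribution u v) paramP≡p₀ paramQ≡1+c₀ ⟨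
      contribution u v (paramP e) (paramQ e) ∎
      where
      open ≡-Reasoning
      T : ℤ
      T = u ^ suc (suc p₀) * v ^ 1
      c : ℕ
      c = count child? (interval a (suc l))
      upTo-N : upTo N ≡ upTo a ++ interval a (suc l)
      upTo-N = trans (cong upTo (sym a+[1+l]≡N)) (upTo-++-interval a (suc l))
      collect : ∀ u v U V W X →
                (u - v) * (X * (u * (u * U) * (v * 1ℤ))) + (u * (u * U) * (v * W) - u * (v * W) * (v * V))
                  ≡ u * (u * (U * (v * W)) - v * (V * (v * W)))
                    + (u - v) * (u * (u * 1ℤ)) * v * ((1ℤ + X) * U - U * 1ℤ)
      collect = solve-∀

-- The recurrence

monomial : ℤ → ℤ → ∀ {n} → Vec ℕ (suc n) → ℤ
monomial u v e = u ^ paramP e * v ^ paramQ e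

∂monomial : ℤ → ∀ {n} → Vec ℕ (suc n) → ℤ
∂monomial u e = + paramQ e * u ^ paramP e

-- In f-as-sum and df-as-sum, `_` stands for the summation function local to f (resp. df) in
-- Defs, which has no name outside it; abstracting the summed list lets unification solve it.
f-as-sum : ∀ n u v → f (suc n) u v ≡ sumMap (monomial u v) (avoiders (suc n))
f-as-sum n u v = unfold
  where
  local-sum≗foldr : ∀ zs → _ ≡ foldr _+_ 0ℤ zs
  local-sum≗foldr = foldr-universal _ _+_ 0ℤ refl (λ _ _ → refl)
  unfold : f (suc n) u v ≡ sumMap (monomial u v) (avoiders (suc n))
  unfold with map (monomial u v) (avoiders (suc n))
  ... | ws = local-sum≗foldr ws

df-as-sum : ∀ n u → df (suc n) u ≡ sumMap (∂monomial u) (avoiders (suc n))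
df-as-sum n u = unfold
  where
  local-sum≗foldr : ∀ zs → _ ≡ foldr _+_ 0ℤ zs
  local-sum≗foldr = foldr-universal _ _+_ 0ℤ refl (λ _ _ → refl)
  unfold : df (suc n) u ≡ sumMap (∂monomial u) (avoiders (suc n))
  unfold with map (∂monomial u) (avoiders (suc n))
  ... | ws = local-sum≗foldr ws

monomial-sum-step : ∀ m u v →
                    (u - v) * sumMap (monomial u v) (avoiders (suc (suc m)))
                      ≡ sumMap (λ e → contribution u v (paramP e) (paramQ e)) (avoiders (suc m))
monomial-sum-step m u v = begin
  (u - v) * sumMap (monomial u v) (avoiders (suc (suc m)))
    ≡⟨ cong (λ es → (u - v) * sumMap (monomial u v) es)
            (avoiders-extend (upTo (suc (suc m))) (invSeqs (suc m))) ⟩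
  (u - v) * sumMap (monomial u v) (concatMap extensions A)
    ≡⟨ cong ((u - v) *_) (sumMap-concatMap (monomial u v) extensions A) ⟩
  (u - v) * sumMap (sumMap (monomial u v) ∘ extensions) A
    ≡⟨ *-sumMap (u - v) _ A ⟩
  sumMap (λ e → (u - v) * sumMap (monomial u v) (extensions e)) A
    ≡⟨ sumMap-cong (All.zipWith per-sequence
                     (all-filter avoids? (invSeqs (suc m)) , filter⁺ avoids? (invSeqs-bounded (suc m)))) ⟩
  sumMap (λ e → contribution u v (paramP e) (paramQ e)) A ∎
  where
  open ≡-Reasoning
  A : List (Vec ℕ (suc m))
  A = avoiders (suc m)
  extensions : Vec ℕ (suc m) → List (Vec ℕ (suc (suc m)))
  extensions e = map (e ∷ʳ_) (children e)
  per-sequence : ∀ {e} → Avoids e × Vec.All (_< suc m) e →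
                 (u - v) * sumMap (monomial u v) (extensions e) ≡ contribution u v (paramP e) (paramQ e)
  per-sequence {e} (avoids , bounded) =
    trans (cong ((u - v) *_) (sumMap-map (monomial u v) (e ∷ʳ_) (children e)))
          (Children.children-sum e avoids bounded u v)

recurrence : ∀ m u v →
             (u - v) * f (suc (suc m)) u v
               ≡ rhs u v (f (suc m) u v) (f (suc m) v v) (df (suc m) u) (f (suc m) u 1ℤ)
recurrence m u v = begin
  (u - v) * f (suc (suc m)) u v
    ≡⟨ cong ((u - v) *_) (f-as-sum (suc m) u v) ⟩
  (u - v) * sumMap (monomial u v) (avoiders (suc (suc m)))
    ≡⟨ monomial-sum-step m u v ⟩
  sumMap (λ e → contribution u v (paramP e) (paramQ e)) A
    ≡⟨ rhs-sumMap u v (monomial u v) (monomial v v) (∂monomial u) (monomial u 1ℤ) A ⟨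
  rhs u v (sumMap (monomial u v) A) (sumMap (monomial v v) A)
          (sumMap (∂monomial u) A) (sumMap (monomial u 1ℤ) A)
    ≡⟨ cong₂ (λ F G → rhs u v F G (sumMap (∂monomial u) A) (sumMap (monomial u 1ℤ) A))
             (f-as-sum m u v) (f-as-sum m v v) ⟨
  rhs u v (f (suc m) u v) (f (suc m) v v) (sumMap (∂monomial u) A) (sumMap (monomial u 1ℤ) A)
    ≡⟨ cong₂ (rhs u v (f (suc m) u v) (f (suc m) v v)) (df-as-sum m u) (f-as-sum m u 1ℤ) ⟨
  rhs u v (f (suc m) u v) (f (suc m) v v) (df (suc m) u) (f (suc m) u 1ℤ) ∎
  where
  open ≡-Reasoning
  A : List (Vec ℕ (suc m))
  A = avoiders (suc m)

f-one : ∀ u v → f 1 u v ≡ u * v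
f-one u v = trans (ℤ.+-identityʳ _) (cong₂ _*_ (ℤ.*-identityʳ u) (ℤ.*-identityʳ v))

proposition4p6 : ((u v : ℤ) → f 1 u v ≡ u * v)
    × ((n : ℕ) → 2 ≤ n → (u v : ℤ) →
        (u - v) * f n u v
          ≡ u * (u * f (n ∸ 1) u v - v * f (n ∸ 1) v v)
            + (u - v) * (u ^ 2) * v * (df (n ∸ 1) u - f (n ∸ 1) u 1ℤ))
proposition4p6 = f-one , λ where
  (suc (suc m)) (s≤s (s≤s z≤n)) → recurrence m
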